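{- Let $H$ be an embedded connected planar graph, and let $U$ be the set of vertices of $H$ contained in some vertex set $X$ with $|X|\le 2$ such that $H-X$ is disconnected. Then the rigidization $H^{\otimes U}$ is 3-connected.
   Context: A graph is 3-connected if there is no set of at most two vertices whose removal disconnects it. Let $H$ be an embedded planar graph and $U\subseteq V(H)$. The rigidization of $H$ around $U$ is the embedded graph $H^{\otimes U}$ obtained from $H$ as follows: for each edge $uv\in E(H)$ with $\{u,v\}\cap U\neq\emptyset$, introduce two new copies of $uv$ drawn at $\varepsilon$-distance from $uv$; subdivide $uv$ and each of its copies by $|\{u,v\}\cap U|$ new vertices (subdivision vertices), placed at $\varepsilon$-distance from each endpoint lying in $U$ (one near each such endpoint); finally, for each $u\in U$, add the unique planar cycle through all subdivision vertices at $\varepsilon$-distance from $u$ (in the cyclic order around $u$). -}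

module Defs where

open import Data.Nat using (ℕ; zero; suc; _+_; _*_; _≤_; _≤ᵇ_)
open import Data.Fin using (Fin; toℕ) renaming (zero to f0; suc to fs)
open import Data.Bool using (Bool; true; false; T; not; if_then_else_)
open import Data.Product using (Σ; ∃; _×_; _,_; proj₁; proj₂)
open import Data.Sum using (_⊎_; inj₁; inj₂)
open import Data.List using (List; []; length; allFin; cartesianProduct; map; upTo)
open import Data.Nat.ListAction using (sum)
open import Data.Bool.ListAction using (all)
open import Data.List.Membership.Propositional using (_∈_)
open import Function using (_∘_)
open import Relation.Nullary using (¬_)
open import Relation.Binary.PropositionalEquality using (_≡_; _≢_)
open import Relation.Binary.Construct.Closure.ReflexiveTransitive using (Star)

record Graph : Set₁ where
  field
    V : Set
    E : V → V → Set

module _ (G : Graph) where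
  open Graph G

  Step : List V → V → V → Set
  Step X a b = (E a b ⊎ E b a) × ¬ (a ∈ X) × ¬ (b ∈ X)

  Disconnected : List V → Set
  Disconnected X = Σ V λ a → Σ V λ b →
    ¬ (a ∈ X) × ¬ (b ∈ X) × ¬ Star (Step X) a b

  Connected : Set
  Connected = (a b : V) → Star (Step []) a b

  ThreeConnected : Set
  ThreeConnected = (X : List V) → length X ≤ 2 → ¬ Disconnected X

-- Embedded (loopless, multi-)graphs as rotation systems.
-- Edges are Fin m; each edge e has two darts (e , false) (tail side)
-- and (e , true) (head side).  σ is the rotation (cyclic order of darts
-- around each vertex, counter-clockwise).

Dart : ℕ → Set
Dart m = Fin m × Bool

flipD : ∀ {m} → Dart m → Dart m
flipD (e , b) = e , not b

iter : ∀ {A : Set} → (A → A) → ℕ → A → A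
iter f zero x = x
iter f (suc k) x = f (iter f k x)

record EmbeddedGraph : Set where
  field
    n m    : ℕ
    vert   : Dart m → Fin n
    σ σ⁻   : Dart m → Dart m
    σσ⁻    : ∀ d → σ (σ⁻ d) ≡ d
    σ⁻σ    : ∀ d → σ⁻ (σ d) ≡ d
    σ-vert : ∀ d → vert (σ d) ≡ vert d
    σ-cyc  : ∀ d d' → vert d ≡ vert d' → ∃ λ k → iter σ k d ≡ d'
    loopless : ∀ e → vert (e , false) ≢ vert (e , true)

module _ (H : EmbeddedGraph) where
  open EmbeddedGraph H

  underlying : Graph
  underlying = record
    { V = Fin n
    ; E = λ u v → Σ (Fin m) λ e → vert (e , false) ≡ u × vert (e , true) ≡ v }

  -- faces = orbits of φ = σ ∘ flip ; count orbits by their minimal dart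
  darts : List (Dart m)
  darts = cartesianProduct (allFin m) (true Data.List.∷ false Data.List.∷ [])

  dartIndex : Dart m → ℕ
  dartIndex (e , b) = 2 * toℕ e + (if b then 1 else 0)

  φ : Dart m → Dart m
  φ = σ ∘ flipD

  isFaceRep : Dart m → Bool
  isFaceRep d = all (λ k → dartIndex d ≤ᵇ dartIndex (iter φ k d)) (upTo (2 * m))

  numFaces : ℕ
  numFaces = sum (map (λ d → if isFaceRep d then 1 else 0) darts)

  -- planar embedding of a connected graph: Euler's formula V - E + F = 2
  -- (an edgeless graph is trivially planar)
  Planar : Set
  Planar = m ≡ 0 ⊎ n + numFaces ≡ m + 2

  module Rigid (U : Fin n → Bool) where
    -- copy 0 is the original edge, copies 1 and 2 are drawn on either side.
    -- Around the tail of an edge the ccw order of the three parallel edges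
    -- is 1,0,2; around the head it is 2,0,1.
    first last : Bool → Fin 3
    first false = fs f0
    first true  = fs (fs f0)
    last  false = fs (fs f0)
    last  true  = fs f0

    -- original vertices, and subdivision vertices: for a dart d at a
    -- vertex of U and a copy c, the subdivision vertex of copy c of the
    -- edge of d near the endpoint vert d
    RV : Set
    RV = Fin n ⊎ Σ (Dart m × Fin 3) (λ p → T (U (vert (proj₁ p))))

    data RE : RV → RV → Set where
      orig   : ∀ e → T (not (U (vert (e , false)))) → T (not (U (vert (e , true)))) →
               RE (inj₁ (vert (e , false))) (inj₁ (vert (e , true)))
      spoke  : ∀ d c p → RE (inj₁ (vert d)) (inj₂ ((d , c) , p))
      outer  : ∀ d c p → T (not (U (vert (flipD d)))) →
               RE (inj₂ ((d , c) , p)) (inj₁ (vert (flipD d)))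
      middle : ∀ e c p q →
               RE (inj₂ (((e , false) , c) , p)) (inj₂ (((e , true) , c) , q))
      ring₁  : ∀ d p → RE (inj₂ ((d , first (proj₂ d)) , p)) (inj₂ ((d , f0) , p))
      ring₂  : ∀ d p → RE (inj₂ ((d , f0) , p)) (inj₂ ((d , last (proj₂ d)) , p))
      ring₃  : ∀ d p q → RE (inj₂ ((d , last (proj₂ d)) , p))
                            (inj₂ ((σ d , first (proj₂ (σ d))) , q))

    rigidization : Graph
    rigidization = record { V = RV ; E = RE }

  InSmallSeparator : Fin n → Set
  InSmallSeparator v = Σ (List (Fin n)) λ X →
    length X ≤ 2 × v ∈ X × Disconnected underlying X

-- Let Y be a set of at most two vertices of the rigidization.  Every vertex of
-- the rigidization has a home vertex of H: itself, or the vertex of its ring.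
-- Vertices with a common home v stay connected after deleting Y: through the
-- spokes at v if v ∉ Y, and otherwise along the ring of v, a cycle from which Y
-- removes at most one more vertex.  Every edge of H keeps one of its three
-- parallel copies clear of Y.  So paths of H − X, where X consists of the
-- vertices of Y outside U, lift to the rigidization minus Y; and H − X is
-- connected, as |X| ≤ 2 and vertices outside U lie in no small separator.
module Submission where

open import Defs
open import Data.Fin using (Fin)
open import Data.Bool using (Bool; T)
open import Function using (_⇔_)

open import Data.Nat using (zero; suc; _≤_; _<_; s≤s)
open import Data.Nat.Properties using (≤-trans; ≤-<-trans)
open import Data.Fin using () renaming (zero to f0; suc to fs)
import Data.Fin.Properties as Fin
open import Data.Bool using (true; false; not; if_then_else_)
import Data.Bool.Properties as Bool
open import Data.Maybe using (Maybe; just; nothing)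
open import Data.Product using (∃; ∃₂; _×_; _,_; proj₁; proj₂)
import Data.Product.Properties as Product
open import Data.Sum using (_⊎_; inj₁; inj₂; swap)
import Data.Sum.Properties as Sum
open import Data.List using (List; []; _∷_; length; lookup; mapMaybe)
open import Data.List.Properties using (length-mapMaybe)
open import Data.List.Membership.Propositional using (_∈_; _∉_)
import Data.List.Membership.DecPropositional as DecMembership
open import Data.List.Relation.Unary.Any using (here; there; index)
open import Data.List.Relation.Unary.Any.Properties using (lookup-index)
open import Data.Empty using (⊥-elim)
open import Relation.Nullary using (¬_; yes; no)
open import Relation.Nullary.Decidable using (T?)
open import Relation.Binary using (Rel; DecidableEquality)
open import Relation.Binary.PropositionalEquality
  using (_≡_; _≢_; _≗_; refl; sym; trans; cong; subst)
open import Relation.Binary.Construct.Closure.ReflexiveTransitive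
  using (Star; ε; _◅_; _◅◅_; gmap; kleisliStar; reverse)
open import Function using (_∘_; id)
open import Function.Bundles using (Equivalence)

T-not : ∀ {b} → ¬ T b → T (not b)
T-not {false} _ = _
T-not {true} ¬t = ⊥-elim (¬t _)

other-member : ∀ {A : Set} {Y : List A} {y} → length Y ≤ 2 → y ∈ Y →
         ∃ λ o → o ∈ Y × (∀ {w} → w ∈ Y → w ≡ y ⊎ w ≡ o)
other-member {Y = y₁ ∷ []} _ _ = y₁ , here refl , λ { (here refl) → inj₂ refl }
other-member {Y = y₁ ∷ y₂ ∷ []} _ (here refl) =
  y₂ , there (here refl) , λ { (here refl) → inj₁ refl ; (there (here refl)) → inj₂ refl }
other-member {Y = y₁ ∷ y₂ ∷ []} _ (there (here refl)) =
  y₁ , here refl , λ { (here refl) → inj₂ refl ; (there (here refl)) → inj₁ refl }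
other-member {Y = _ ∷ _ ∷ _ ∷ _} (s≤s (s≤s ())) _

module _ {A B : Set} (f : A → Maybe B) where

  ∈-mapMaybe⁺ : ∀ {xs x y} → x ∈ xs → f x ≡ just y → y ∈ mapMaybe f xs
  ∈-mapMaybe⁺ {x ∷ _} (here refl) fx≡y rewrite fx≡y = here refl
  ∈-mapMaybe⁺ {x ∷ _} (there x∈) fx≡y with f x
  ... | nothing = ∈-mapMaybe⁺ x∈ fx≡y
  ... | just _ = there (∈-mapMaybe⁺ x∈ fx≡y)

  ∈-mapMaybe⁻ : ∀ {xs y} → y ∈ mapMaybe f xs → ∃ λ x → x ∈ xs × f x ≡ just y
  ∈-mapMaybe⁻ {x ∷ xs} y∈ with f x in fx≡ | y∈
  ... | just _ | here refl = x , here refl , fx≡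
  ... | just _ | there y∈′ = let z , z∈ , fz≡ = ∈-mapMaybe⁻ y∈′ in z , there z∈ , fz≡
  ... | nothing | y∈′ = let z , z∈ , fz≡ = ∈-mapMaybe⁻ y∈′ in z , there z∈ , fz≡

∃-∉ : ∀ {n} (xs : List (Fin n)) → length xs < n → ∃ λ c → c ∉ xs
∃-∉ {n} xs |xs|<n = Fin.¬∀⟶∃¬ n (_∈ xs) (λ c → DecMembership._∈?_ Fin._≟_ c xs) ¬all
  where
  ¬all : ¬ (∀ c → c ∈ xs)
  ¬all all with Fin.pigeonhole |xs|<n (index ∘ all)
  ... | i , j , i<j , same =
    Fin.<⇒≢ i<j (trans (lookup-index (all i))
                  (trans (cong (lookup xs) same) (sym (lookup-index (all j)))))

free-value : ∀ {A : Set} {n} (f : A → Maybe (Fin n)) (ys : List A) → length ys < n →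
             ∃ λ c → ∀ {y} → y ∈ ys → f y ≢ just c
free-value f ys |ys|<n with ∃-∉ (mapMaybe f ys) (≤-<-trans (length-mapMaybe f ys) |ys|<n)
... | c , c∉ = c , λ y∈ fy≡c → c∉ (∈-mapMaybe⁺ f y∈ fy≡c)

module _ {A : Set} (f : A → A) where

  Orbit : Rel A _
  Orbit = Star (λ u v → f u ≡ v)

  MoveIn : (A → Set) → Rel A _
  MoveIn P u v = P u × P v × f u ≡ v

  OrbitIn : (A → Set) → Rel A _
  OrbitIn P = Star (MoveIn P)

  iter-orbit : ∀ k x → Orbit x (iter f k x)
  iter-orbit zero x = ε
  iter-orbit (suc k) x = iter-orbit k x ◅◅ (refl ◅ ε)

  orbitIn-source : ∀ {P x y} → OrbitIn P x y → P y → P x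
  orbitIn-source ε Py = Py
  orbitIn-source ((Px , _) ◅ _) _ = Px

  orbitIn-comparable : ∀ {P a x y} → OrbitIn P a x → OrbitIn P a y →
                       OrbitIn P x y ⊎ OrbitIn P y x
  orbitIn-comparable ε q = inj₁ q
  orbitIn-comparable p ε = inj₂ p
  orbitIn-comparable ((_ , _ , refl) ◅ p) ((_ , _ , refl) ◅ q) = orbitIn-comparable p q

  module _ (_≟_ : DecidableEquality A) where

    last-visit : ∀ {z x y} → Orbit x y → y ≢ z →
                 OrbitIn (_≢ z) x y ⊎ OrbitIn (_≢ z) (f z) y
    last-visit ε _ = inj₁ ε
    last-visit {z} {x} (refl ◅ path) y≢z with last-visit path y≢z | x ≟ z
    ... | inj₂ after | _ = inj₂ after
    ... | inj₁ rest | yes refl = inj₂ rest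
    ... | inj₁ rest | no x≢z = inj₁ ((x≢z , orbitIn-source rest y≢z , refl) ◅ rest)

    module _ {B : Set} (g : A → B) (_≟ᴮ_ : DecidableEquality B) (g∘f≗g : g ∘ f ≗ g)
             (fibre-orbit : ∀ {x y} → g x ≡ g y → Orbit x y) where

      orbit-outside-fibre : ∀ {z x y} → g x ≢ g z → Orbit x y → OrbitIn (_≢ z) x y
      orbit-outside-fibre _ ε = ε
      orbit-outside-fibre {x = x} gx≢gz (refl ◅ path) =
        (avoid gx≢gz , avoid gfx≢gz , refl) ◅ orbit-outside-fibre gfx≢gz path
        where
        gfx≢gz = gx≢gz ∘ trans (sym (g∘f≗g x))
        avoid : ∀ {u z} → g u ≢ g z → u ≢ z
        avoid gu≢gz refl = gu≢gz refl

      -- The fibres of g are f-cycles: removing z turns its own fibre into a path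
      -- starting at f z, and leaves the other fibres untouched.
      fibre-minus-point : ∀ z {x y} → g x ≡ g y → x ≢ z → y ≢ z →
                          OrbitIn (_≢ z) x y ⊎ OrbitIn (_≢ z) y x
      fibre-minus-point z {x} {y} gx≡gy x≢z y≢z with g z ≟ᴮ g x
      ... | no gz≢gx = inj₁ (orbit-outside-fibre (gz≢gx ∘ sym) (fibre-orbit gx≡gy))
      ... | yes gz≡gx =
        orbitIn-comparable (after-z gz≡gx x≢z) (after-z (trans gz≡gx gx≡gy) y≢z)
        where
        after-z : ∀ {w} → g z ≡ g w → w ≢ z → OrbitIn (_≢ z) (f z) w
        after-z gz≡gw w≢z with last-visit (fibre-orbit gz≡gw) w≢z
        ... | inj₁ from-z = ⊥-elim (orbitIn-source from-z w≢z refl)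
        ... | inj₂ after = after

module Rigidized (H : EmbeddedGraph) (U : Fin (EmbeddedGraph.n H) → Bool) where
  open EmbeddedGraph H
  open Rigid H U

  Slot : Set
  Slot = Dart m × Fin 3

  base : Slot → Fin n
  base = vert ∘ proj₁

  home : RV → Fin n
  home (inj₁ v) = v
  home (inj₂ (s , _)) = base s

  _≟-slot_ : DecidableEquality Slot
  _≟-slot_ = Product.≡-dec (Product.≡-dec Fin._≟_ Bool._≟_) Fin._≟_

  _≟-RV_ : DecidableEquality RV
  _≟-RV_ = Sum.≡-dec Fin._≟_ (Product.≡-dec _≟-slot_ λ p q → yes (Bool.T-irrelevant p q))

  entry : Dart m → Slot
  entry d = d , first (proj₂ d)

  -- The ring around vert d visits (d , first) , (d , 0) , (d , last) and then
  -- moves on to (σ d , first), following ring₁, ring₂ and ring₃.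
  rot : Slot → Slot
  rot ((e , false) , f0)         = (e , false) , fs (fs f0)
  rot ((e , false) , fs f0)      = (e , false) , f0
  rot ((e , false) , fs (fs f0)) = entry (σ (e , false))
  rot ((e , true) , f0)          = (e , true) , fs f0
  rot ((e , true) , fs f0)       = entry (σ (e , true))
  rot ((e , true) , fs (fs f0))  = (e , true) , f0

  base-rot : base ∘ rot ≗ base
  base-rot ((e , false) , f0)         = refl
  base-rot ((e , false) , fs f0)      = refl
  base-rot ((e , false) , fs (fs f0)) = σ-vert (e , false)
  base-rot ((e , true) , f0)          = refl
  base-rot ((e , true) , fs f0)       = σ-vert (e , true)
  base-rot ((e , true) , fs (fs f0))  = refl

  rot-edge : ∀ s p q → RE (inj₂ (s , p)) (inj₂ (rot s , q))
  rot-edge ((e , false) , f0) p q with refl ← Bool.T-irrelevant p q = ring₂ (e , false) p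
  rot-edge ((e , false) , fs f0) p q with refl ← Bool.T-irrelevant p q = ring₁ (e , false) p
  rot-edge ((e , false) , fs (fs f0)) p q = ring₃ (e , false) p q
  rot-edge ((e , true) , f0) p q with refl ← Bool.T-irrelevant p q = ring₂ (e , true) p
  rot-edge ((e , true) , fs f0) p q = ring₃ (e , true) p q
  rot-edge ((e , true) , fs (fs f0)) p q with refl ← Bool.T-irrelevant p q = ring₁ (e , true) p

  rot-to-entry : ∀ s → Orbit rot s (entry (σ (proj₁ s)))
  rot-to-entry ((e , false) , f0)         = refl ◅ refl ◅ ε
  rot-to-entry ((e , false) , fs f0)      = refl ◅ refl ◅ refl ◅ ε
  rot-to-entry ((e , false) , fs (fs f0)) = refl ◅ ε
  rot-to-entry ((e , true) , f0)          = refl ◅ refl ◅ ε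
  rot-to-entry ((e , true) , fs f0)       = refl ◅ ε
  rot-to-entry ((e , true) , fs (fs f0))  = refl ◅ refl ◅ refl ◅ ε

  entry-to : ∀ s → Orbit rot (entry (proj₁ s)) s
  entry-to ((e , false) , f0)         = refl ◅ ε
  entry-to ((e , false) , fs f0)      = ε
  entry-to ((e , false) , fs (fs f0)) = refl ◅ refl ◅ ε
  entry-to ((e , true) , f0)          = refl ◅ ε
  entry-to ((e , true) , fs f0)       = refl ◅ refl ◅ ε
  entry-to ((e , true) , fs (fs f0))  = ε

  entry-orbit : ∀ {d d'} → Orbit σ d d' → Orbit rot (entry d) (entry d')
  entry-orbit = kleisliStar entry λ { refl → rot-to-entry (entry _) }

  rot-orbit : ∀ {s s'} → base s ≡ base s' → Orbit rot s s'
  rot-orbit {s} {s'} bs≡bs'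
    with σ-cyc (σ (proj₁ s)) (proj₁ s') (trans (σ-vert (proj₁ s)) bs≡bs')
  ... | k , refl = rot-to-entry s ◅◅ entry-orbit (iter-orbit σ k (σ (proj₁ s))) ◅◅ entry-to s'

  module Deleting (Y : List RV) (|Y|≤2 : length Y ≤ 2) where

    Path : Rel RV _
    Path = Star (Step rigidization Y)

    reverse-path : ∀ {x y} → Path x y → Path y x
    reverse-path = reverse λ { (x—y , x∉ , y∉) → swap x—y , y∉ , x∉ }

    Intact : Slot → Set
    Intact s = ∀ p → inj₂ (s , p) ∉ Y

    rim-path : ∀ {P s s'} → (∀ {t} → P t → Intact t) → OrbitIn rot P s s' →
               ∀ p p' → Path (inj₂ (s , p)) (inj₂ (s' , p'))
    rim-path {s = s} _ ε p p' =
      subst (λ q → Path (inj₂ (s , p)) (inj₂ (s , q))) (Bool.T-irrelevant p p') ε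
    rim-path intact ((Ps , Prs , refl) ◅ path) p p' =
      (inj₁ (rot-edge _ p q) , intact Ps p , intact Prs q) ◅ rim-path intact path q p'
      where q = subst (T ∘ U) (sym (base-rot _)) p

    rim-path-avoiding : ∀ z → (∀ {t} → t ≢ z → Intact t) → ∀ {s s'} p p' →
                        base s ≡ base s' → s ≢ z → s' ≢ z → Path (inj₂ (s , p)) (inj₂ (s' , p'))
    rim-path-avoiding z intact p p' bs≡bs' s≢z s'≢z
      with fibre-minus-point rot _≟-slot_ base Fin._≟_ base-rot rot-orbit z bs≡bs' s≢z s'≢z
    ... | inj₁ path = rim-path intact path p p'
    ... | inj₂ path = reverse-path (rim-path intact path p' p)

    rim-connected : ∀ {s s'} p p' → base s ≡ base s' → inj₁ (base s) ∈ Y →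
                    inj₂ (s , p) ∉ Y → inj₂ (s' , p') ∉ Y → Path (inj₂ (s , p)) (inj₂ (s' , p'))
    rim-connected p p' bs≡bs' hub∈ s∉ s'∉ with other-member |Y|≤2 hub∈
    ... | inj₁ _ , _ , Y⊆ =
      rim-path id (gmap id (λ step → intact , intact , step) (rot-orbit bs≡bs')) p p'
      where
      intact : ∀ {t} → Intact t
      intact _ t∈ with Y⊆ t∈
      ... | inj₁ ()
      ... | inj₂ ()
    ... | inj₂ (z , pz) , z∈ , Y⊆ = rim-path-avoiding z intact p p' bs≡bs' (≢z s∉) (≢z s'∉)
      where
      intact : ∀ {t} → t ≢ z → Intact t
      intact t≢z _ t∈ with Y⊆ t∈
      ... | inj₂ refl = t≢z refl
      ≢z : ∀ {t q} → inj₂ (t , q) ∉ Y → t ≢ z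
      ≢z {q = q} t∉ refl =
        t∉ (subst (_∈ Y) (cong (λ r → inj₂ (z , r)) (Bool.T-irrelevant pz q)) z∈)

    hub-path : ∀ {v s p} → base s ≡ v → inj₁ v ∉ Y → inj₂ (s , p) ∉ Y →
               Path (inj₁ v) (inj₂ (s , p))
    hub-path {s = s} {p} refl hub∉ s∉ = (inj₁ (spoke (proj₁ s) (proj₂ s) p) , hub∉ , s∉) ◅ ε

    cluster-connected : ∀ {x y} → home x ≡ home y → x ∉ Y → y ∉ Y → Path x y
    cluster-connected {inj₁ _} {inj₁ _} refl _ _ = ε
    cluster-connected {inj₁ _} {inj₂ _} v≡bs v∉ y∉ = hub-path (sym v≡bs) v∉ y∉
    cluster-connected {inj₂ _} {inj₁ _} bs≡v x∉ v∉ = reverse-path (hub-path bs≡v v∉ x∉)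
    cluster-connected {inj₂ (s , p)} {inj₂ (s' , p')} bs≡bs' x∉ y∉
      with DecMembership._∈?_ _≟-RV_ (inj₁ (base s)) Y
    ... | yes hub∈ = rim-connected p p' bs≡bs' hub∈ x∉ y∉
    ... | no hub∉ = reverse-path (hub-path refl hub∉ x∉) ◅◅ hub-path (sym bs≡bs') hub∉ y∉

    trace : RV → Maybe (Fin n)
    trace (inj₁ v) = if U v then nothing else just v
    trace (inj₂ _) = nothing

    X : List (Fin n)
    X = mapMaybe trace Y

    |X|≤2 : length X ≤ 2
    |X|≤2 = ≤-trans (length-mapMaybe trace Y) |Y|≤2

    ∈X⁺ : ∀ {v} → inj₁ v ∈ Y → ¬ T (U v) → v ∈ X
    ∈X⁺ {v} v∈ v∉U = ∈-mapMaybe⁺ trace v∈ (trace-outside-U (U v) v∉U)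
      where
      trace-outside-U : ∀ b → ¬ T b → (if b then nothing else just v) ≡ just v
      trace-outside-U false _ = refl
      trace-outside-U true t = ⊥-elim (t _)

    ∈X⁻ : ∀ {v} → v ∈ X → inj₁ v ∈ Y × ¬ T (U v)
    ∈X⁻ v∈ with ∈-mapMaybe⁻ trace v∈
    ... | inj₁ u , u∈ , trace≡ with U u in Uu | trace≡
    ...   | false | refl = u∈ , λ t → subst T Uu t
    ∈X⁻ v∈ | inj₂ _ , _ , ()

    home∉X : ∀ {x} → x ∉ Y → home x ∉ X
    home∉X {inj₁ _} v∉ v∈ = v∉ (proj₁ (∈X⁻ v∈))
    home∉X {inj₂ (_ , p)} _ v∈ = proj₂ (∈X⁻ v∈) p

    copy-of : Fin m → RV → Maybe (Fin 3)
    copy-of _ (inj₁ _) = nothing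
    copy-of e (inj₂ (((e' , _) , c) , _)) with e' Fin.≟ e
    ... | yes _ = just c
    ... | no _ = nothing

    copy-of-own : ∀ e b c p → copy-of e (inj₂ (((e , b) , c) , p)) ≡ just c
    copy-of-own e b c p with e Fin.≟ e
    ... | yes _ = refl
    ... | no e≢e = ⊥-elim (e≢e refl)

    end : Dart m → Fin 3 → RV
    end d c with T? (U (vert d))
    ... | yes p = inj₂ ((d , c) , p)
    ... | no _ = inj₁ (vert d)

    home-end : ∀ d c → home (end d c) ≡ vert d
    home-end d c with T? (U (vert d))
    ... | yes _ = refl
    ... | no _ = refl

    end∉ : ∀ {e c} → (∀ {y} → y ∈ Y → copy-of e y ≢ just c) → ∀ b →
           vert (e , b) ∉ X → end (e , b) c ∉ Y
    end∉ {e} {c} free b v∉X with T? (U (vert (e , b)))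
    ... | yes p = λ y∈ → free y∈ (copy-of-own e b c p)
    ... | no v∉U = λ v∈ → v∉X (∈X⁺ v∈ v∉U)

    end-adjacent : ∀ e c → RE (end (e , false) c) (end (e , true) c)
                         ⊎ RE (end (e , true) c) (end (e , false) c)
    end-adjacent e c with T? (U (vert (e , false))) | T? (U (vert (e , true)))
    ... | yes p | yes q = inj₁ (middle e c p q)
    ... | yes p | no q∉ = inj₁ (outer (e , false) c p (T-not q∉))
    ... | no p∉ | yes q = inj₂ (outer (e , true) c q (T-not p∉))
    ... | no p∉ | no q∉ = inj₁ (orig e (T-not p∉) (T-not q∉))

    edge-step : ∀ e → vert (e , false) ∉ X → vert (e , true) ∉ X →
                ∃ λ c → Step rigidization Y (end (e , false) c) (end (e , true) c)
    edge-step e tail∉ head∉ with free-value (copy-of e) Y (s≤s |Y|≤2)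
    ... | c , free = c , end-adjacent e c , end∉ free false tail∉ , end∉ free true head∉

    lift-step : ∀ {u u'} → Step (underlying H) X u u' →
                ∃₂ λ a b → home a ≡ u × home b ≡ u' × Step rigidization Y a b
    lift-step (inj₁ (e , refl , refl) , u∉ , u'∉) with edge-step e u∉ u'∉
    ... | c , a—b = _ , _ , home-end _ c , home-end _ c , a—b
    lift-step (inj₂ (e , refl , refl) , u∉ , u'∉) with edge-step e u'∉ u∉
    ... | c , (a—b , a∉ , b∉) = _ , _ , home-end _ c , home-end _ c , (swap a—b , b∉ , a∉)

    lift : ∀ {u w} → Star (Step (underlying H) X) u w →
           ∀ {x y} → home x ≡ u → home y ≡ w → x ∉ Y → y ∉ Y → Path x y
    lift ε hx hy x∉ y∉ = cluster-connected (trans hx (sym hy)) x∉ y∉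
    lift (u—u' ◅ path) hx hy x∉ y∉ with lift-step u—u'
    ... | a , b , ha , hb , a—b@(_ , a∉ , b∉) =
      cluster-connected (trans hx (sym ha)) x∉ a∉ ◅◅ a—b ◅ lift path hb hy b∉ y∉

outside-U⇒¬Disconnected : ∀ H (U : Fin (EmbeddedGraph.n H) → Bool) → Connected (underlying H) →
  (∀ v → InSmallSeparator H v → T (U v)) →
  ∀ {X} → length X ≤ 2 → (∀ {v} → v ∈ X → ¬ T (U v)) → ¬ Disconnected (underlying H) X
outside-U⇒¬Disconnected H U conn _ {[]} _ _ (a , b , _ , _ , a↛b) = a↛b (conn a b)
outside-U⇒¬Disconnected H U conn separator⇒U {v ∷ X} |X|≤2 outside-U disconnected =
  outside-U (here refl) (separator⇒U v (v ∷ X , |X|≤2 , here refl , disconnected))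

lemma12 : (H : EmbeddedGraph) → Planar H → Connected (underlying H) →
    (U : Fin (EmbeddedGraph.n H) → Bool) →
    (∀ v → T (U v) ⇔ InSmallSeparator H v) →
    ThreeConnected (Rigid.rigidization H U)
lemma12 H _ conn U U⇔separator Y |Y|≤2 (a , b , a∉ , b∉ , a↛b) =
  outside-U⇒¬Disconnected H U conn (Equivalence.from ∘ U⇔separator) |X|≤2 (proj₂ ∘ ∈X⁻)
    (home a , home b , home∉X a∉ , home∉X b∉ , λ path → a↛b (lift path refl refl a∉ b∉))
  where
  open Rigidized H U
  open Deleting Y |Y|≤2
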